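{- Let $G\le\mathfrak{S}_n$. The complex $(\mathcal{C}(\mathbb{F}_2)^G,D)$ is acyclic when $n$ is odd; more generally, it is acyclic whenever $G$ has at least one orbit of odd cardinality in its action on $[n]$. If $(\mathcal{C}(\mathbb{F}_2)^G,D)$ is not acyclic, then $H_0(\mathcal{C}(\mathbb{F}_2)^G,D)\cong\mathbb{F}_2$ and $H_1(\mathcal{C}(\mathbb{F}_2)^G,D)=0$.
   Context: $G\le\mathfrak{S}_n$ acts on $[n]$ and on subsets of $[n]$. Let $V$ be the $\mathbb{F}_2$-space with basis $\{e_0,e_1\}$, $\mathcal{C}(\mathbb{F}_2)=V^{\otimes n}$ with basis $e_S$ ($S\subseteq[n]$; $e_S=e_{i_1}\otimes\cdots\otimes e_{i_n}$ with $i_j=1$ iff $j\in S$), graded by $|S|$, with $G$ permuting the $e_S$. $\mathcal{C}(\mathbb{F}_2)^G$ is the subspace of $G$-invariant vectors (graded), and $D(e_S)=\sum_{j\in S}e_{S\setminus\{j\}}$ induces a boundary map of degree $-1$ on it with $D^2=0$. Acyclic means all homology groups vanish. -}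

module Defs where

open import Data.Nat using (ℕ; zero; suc; _%_)
open import Data.Bool using (Bool; true; false; _xor_; if_then_else_)
open import Data.Fin using (Fin)
open import Data.Fin.Subset using (Subset; ∣_∣; _∈_)
open import Data.Fin.Permutation using (Permutation′; _⟨$⟩ʳ_; _⟨$⟩ˡ_; id; flip; _∘ₚ_)
open import Data.Vec using (lookup; tabulate; _[_]≔_)
open import Data.Product using (Σ; ∃; _×_; _,_)
open import Relation.Binary.PropositionalEquality using (_≡_)
open import Relation.Nullary using (¬_)
open import Function.Bundles using (_⇔_)

record Subgroup (n : ℕ) : Set₁ where
  field
    _∈G : Permutation′ n → Set
    id∈G : id ∈G
    ∘∈G : ∀ {g h} → g ∈G → h ∈G → (g ∘ₚ h) ∈G
    inv∈G : ∀ {g} → g ∈G → flip g ∈G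
open Subgroup public

-- Action of a permutation on subsets: g · S = { g(i) | i ∈ S }.
act : ∀ {n} → Permutation′ n → Subset n → Subset n
act g S = tabulate (λ i → lookup S (g ⟨$⟩ˡ i))

IsOrbit : ∀ {n} → Subgroup n → Subset n → Set
IsOrbit {n} G O = Σ (Fin n) λ i → ∀ j → (j ∈ O) ⇔ (Σ (Permutation′ n) λ g → ((G ∈G) g) × (g ⟨$⟩ʳ i ≡ j))

HasOddOrbit : ∀ {n} → Subgroup n → Set
HasOddOrbit {n} G = Σ (Subset n) λ O → IsOrbit G O × (∣ O ∣ % 2 ≡ 1)

-- Vectors of 𝒞(𝔽₂) = V^{⊗n}: coefficient functions S ↦ coefficient of e_S (𝔽₂ = Bool, + = xor).
Vect : ℕ → Set
Vect n = Subset n → Bool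

_⊕_ : ∀ {n} → Vect n → Vect n → Vect n
(v ⊕ w) S = v S xor w S

xorSum : ∀ {n} → (Fin n → Bool) → Bool
xorSum {zero} f = false
xorSum {suc n} f = f Fin.zero xor xorSum (λ j → f (Fin.suc j))

-- Boundary D(e_S) = Σ_{j∈S} e_{S∖{j}}, extended linearly:
-- coefficient of e_T in D v is Σ_{j ∉ T} v(T ∪ {j}).
D : ∀ {n} → Vect n → Vect n
D v T = xorSum (λ j → if lookup T j then false else v (T [ j ]≔ true))

Chain : ∀ {n} → Subgroup n → ℕ → Vect n → Set
Chain {n} G k v =
  (∀ S → ¬ (∣ S ∣ ≡ k) → v S ≡ false) ×
  (∀ g → (G ∈G) g → ∀ S → v (act g S) ≡ v S)

Cycle : ∀ {n} → Subgroup n → ℕ → Vect n → Set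
Cycle G k v = Chain G k v × (∀ T → D v T ≡ false)

Boundary : ∀ {n} → Subgroup n → ℕ → Vect n → Set
Boundary {n} G k v = Σ (Vect n) λ w → Chain G (suc k) w × (∀ T → D w T ≡ v T)

HomologyVanishes : ∀ {n} → Subgroup n → ℕ → Set
HomologyVanishes G k = ∀ v → Cycle G k v → Boundary G k v

Acyclic : ∀ {n} → Subgroup n → Set
Acyclic G = ∀ k → HomologyVanishes G k

-- H_k ≅ 𝔽₂: an 𝔽₂-linear map φ on cycles, surjective onto 𝔽₂, with kernel exactly the
-- boundaries (so φ induces an isomorphism Z_k / B_k ≅ 𝔽₂).
HomologyIsF2 : ∀ {n} → Subgroup n → ℕ → Set
HomologyIsF2 {n} G k = Σ (Vect n → Bool) λ φ →
  (∀ v w → Cycle G k v → Cycle G k w → φ (v ⊕ w) ≡ (φ v xor φ w)) ×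
  (∀ v → Cycle G k v → (φ v ≡ false) ⇔ Boundary G k v) ×
  (Σ (Vect n) λ v → Cycle G k v × (φ v ≡ true))

module Submission where

-- Over 𝔽₂ the complex 𝒞 is the exterior algebra on e₁ … eₙ, and D is the derivation contracting
-- with e₁* + … + eₙ*. Multiplication by a degree-one element e_u = Σ uᵢ eᵢ is therefore a
-- null-homotopy of (Σ uᵢ) · id, and it preserves G-invariant chains when u is G-invariant.
-- An orbit of odd size (or, for n odd, all of [n]) gives an invariant u with Σ uᵢ = 1, so the
-- complex is acyclic. If no invariant u has odd weight, v ↦ v(∅) computes H₀: a degree-one
-- chain w with (D w)(∅) = 1 would be such a u. Finally every 1-cycle bounds the sum of the
-- pairs inside its support, with no hypothesis on G.

open import Defs
open import Algebra.Bundles using (CommutativeRing)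
import Algebra.Properties.CommutativeMonoid.Sum as CommutativeMonoidSum
import Algebra.Properties.CommutativeSemigroup as CommutativeSemigroupProperties
import Algebra.Properties.Semiring.Sum as SemiringSum
open import Data.Bool using (Bool; true; false; not; _∧_; _xor_; if_then_else_)
open import Data.Bool.Properties
  using (xor-∧-commutativeRing; xor-same; xor-identityʳ; ∧-identityʳ; ∧-zeroʳ; ∧-idem; not-involutive;
         if-eta; if-cong; if-cong-then)
open import Data.Empty using (⊥-elim)
open import Data.Fin using (Fin; zero; suc)
open import Data.Fin.Permutation using (Permutation′; _⟨$⟩ʳ_; _⟨$⟩ˡ_; flip; _∘ₚ_; inverseˡ; inverseʳ)
open import Data.Fin.Properties using (suc-injective) renaming (_≟_ to _≟ᶠ_)
open import Data.Fin.Subset using (Subset; ∣_∣; _∈_; ⊥; ⊤)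
open import Data.Fin.Subset.Properties using (∣⊥∣≡0; ∣⊤∣≡n)
open import Data.Nat using (ℕ; zero; suc; _+_; _%_; _≟_)
import Data.Nat.Properties as ℕ
open import Data.Product using (Σ; _×_; _,_)
open import Data.Vec using (Vec; []; _∷_; lookup; _[_]≔_)
open import Data.Vec.Properties
  using (lookup∘update; lookup∘update′; lookup∘tabulate; tabulate∘lookup; tabulate-cong;
         []≔-idempotent; []≔-commutes; []≔-lookup; lookup-replicate; []=⇒lookup; lookup⇒[]=)
open import Function using (_∘_)
open import Function.Bundles using (_⇔_; Equivalence; mk⇔)
open import Relation.Binary.PropositionalEquality
open import Relation.Nullary using (¬_; Dec; yes; no; does; contradiction)
open import Relation.Nullary.Decidable using (dec-false)

private
  variable
    n : ℕ

module 𝔽₂-Sum = SemiringSum (CommutativeRing.semiring xor-∧-commutativeRing)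
module ℕ-Sum = CommutativeMonoidSum ℕ.+-0-commutativeMonoid

xorSum≡sum : (f : Fin n → Bool) → xorSum f ≡ 𝔽₂-Sum.sum f
xorSum≡sum {zero} f = refl
xorSum≡sum {suc n} f = cong (f zero xor_) (xorSum≡sum (f ∘ suc))

xorSum-cong : {f g : Fin n → Bool} → (∀ i → f i ≡ g i) → xorSum f ≡ xorSum g
xorSum-cong {zero} f≗g = refl
xorSum-cong {suc n} f≗g = cong₂ _xor_ (f≗g zero) (xorSum-cong (f≗g ∘ suc))

xorSum-zero : {f : Fin n → Bool} → (∀ i → f i ≡ false) → xorSum f ≡ false
xorSum-zero {zero} f≗0 = refl
xorSum-zero {suc n} f≗0 rewrite f≗0 zero = xorSum-zero (f≗0 ∘ suc)

xorSum-single : (f : Fin n → Bool) (i : Fin n) → (∀ j → j ≢ i → f j ≡ false) → xorSum f ≡ f i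
xorSum-single f zero f≗0 =
  trans (cong (f zero xor_) (xorSum-zero (λ j → f≗0 (suc j) λ ()))) (xor-identityʳ (f zero))
xorSum-single f (suc i) f≗0 rewrite f≗0 zero λ () =
  xorSum-single (f ∘ suc) i (λ j j≢i → f≗0 (suc j) (j≢i ∘ suc-injective))

xorSum-xor : (f g : Fin n → Bool) → xorSum (λ i → f i xor g i) ≡ xorSum f xor xorSum g
xorSum-xor f g = begin
  xorSum (λ i → f i xor g i)             ≡⟨ xorSum≡sum (λ i → f i xor g i) ⟩
  𝔽₂-Sum.sum (λ i → f i xor g i)         ≡⟨ 𝔽₂-Sum.∑-distrib-+ f g ⟩
  𝔽₂-Sum.sum f xor 𝔽₂-Sum.sum g          ≡⟨ cong₂ _xor_ (xorSum≡sum f) (xorSum≡sum g) ⟨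
  xorSum f xor xorSum g                  ∎
  where open ≡-Reasoning

xorSum-comm : ∀ {m} (f : Fin m → Fin n → Bool) →
              xorSum (λ i → xorSum (f i)) ≡ xorSum (λ j → xorSum (λ i → f i j))
xorSum-comm f = begin
  xorSum (λ i → xorSum (f i))                          ≡⟨ xorSum-cong (xorSum≡sum ∘ f) ⟩
  xorSum (λ i → 𝔽₂-Sum.sum (f i))                      ≡⟨ xorSum≡sum (λ i → 𝔽₂-Sum.sum (f i)) ⟩
  𝔽₂-Sum.sum (λ i → 𝔽₂-Sum.sum (f i))                  ≡⟨ 𝔽₂-Sum.∑-comm f ⟩
  𝔽₂-Sum.sum (λ j → 𝔽₂-Sum.sum (λ i → f i j))          ≡⟨ xorSum≡sum (λ j → 𝔽₂-Sum.sum (λ i → f i j)) ⟨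
  xorSum (λ j → 𝔽₂-Sum.sum (λ i → f i j))              ≡⟨ xorSum-cong (λ j → xorSum≡sum (λ i → f i j)) ⟨
  xorSum (λ j → xorSum (λ i → f i j))                  ∎
  where open ≡-Reasoning

xorSum-permute : (f : Fin n → Bool) (π : Permutation′ n) → xorSum f ≡ xorSum (f ∘ (π ⟨$⟩ʳ_))
xorSum-permute f π =
  trans (xorSum≡sum f) (trans (𝔽₂-Sum.sum-permute f π) (sym (xorSum≡sum (f ∘ (π ⟨$⟩ʳ_)))))

∧-distribˡ-xorSum : ∀ x (f : Fin n → Bool) → x ∧ xorSum f ≡ xorSum (λ i → x ∧ f i)
∧-distribˡ-xorSum x f =
  trans (cong (x ∧_) (xorSum≡sum f))
        (trans (𝔽₂-Sum.*-distribˡ-sum x f) (sym (xorSum≡sum (λ i → x ∧ f i))))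

-- A map 𝔽₂ → 𝔽₂ fixing 0 is multiplication by its value at 1, hence linear.
xorSum-map : (φ : Bool → Bool) → φ false ≡ false → (f : Fin n → Bool) →
             φ (xorSum f) ≡ xorSum (φ ∘ f)
xorSum-map φ φ0 f = begin
  φ (xorSum f)                 ≡⟨ scaling (xorSum f) ⟩
  φ true ∧ xorSum f            ≡⟨ ∧-distribˡ-xorSum (φ true) f ⟩
  xorSum (λ i → φ true ∧ f i)  ≡⟨ xorSum-cong (sym ∘ scaling ∘ f) ⟩
  xorSum (φ ∘ f)               ∎
  where
  open ≡-Reasoning
  scaling : ∀ x → φ x ≡ φ true ∧ x
  scaling true = sym (∧-identityʳ (φ true))
  scaling false = trans φ0 (sym (∧-zeroʳ (φ true)))

parity : ℕ → Bool
parity zero = false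
parity (suc n) = not (parity n)

parity-odd : ∀ m → m % 2 ≡ 1 → parity m ≡ true
parity-odd 1 _ = refl
parity-odd (suc (suc m)) odd = trans (not-involutive (parity m)) (parity-odd m odd)

xorSum-lookup : (S : Subset n) → xorSum (lookup S) ≡ parity ∣ S ∣
xorSum-lookup [] = refl
xorSum-lookup (true ∷ S) = cong not (xorSum-lookup S)
xorSum-lookup (false ∷ S) = xorSum-lookup S

lookup-ext : ∀ {A : Set} {xs ys : Vec A n} → (∀ i → lookup xs i ≡ lookup ys i) → xs ≡ ys
lookup-ext {xs = xs} {ys} eq = trans (sym (tabulate∘lookup xs)) (trans (tabulate-cong eq) (tabulate∘lookup ys))

[]≔-restore : ∀ {A : Set} (xs : Vec A n) i {x y} → lookup xs i ≡ x → (xs [ i ]≔ y) [ i ]≔ x ≡ xs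
[]≔-restore xs i refl = trans ([]≔-idempotent xs i) ([]≔-lookup xs i)

lookup-⊥ : (i : Fin n) → lookup (⊥ {n}) i ≡ false
lookup-⊥ i = lookup-replicate i false

-- Not the library's ⁅ i ⁆, so as to match the way D inserts elements.
singleton : Fin n → Subset n
singleton i = ⊥ [ i ]≔ true

bit : Bool → ℕ
bit b = if b then 1 else 0

count : (Fin n → Bool) → Subset n → ℕ
count c S = ℕ-Sum.sum (λ i → bit (lookup S i ∧ c i))

∣S∣≡count : (S : Subset n) → ∣ S ∣ ≡ count (λ _ → true) S
∣S∣≡count [] = refl
∣S∣≡count (true ∷ S) = cong suc (∣S∣≡count S)
∣S∣≡count (false ∷ S) = ∣S∣≡count S

count-⊥ : (c : Fin n → Bool) → count c ⊥ ≡ 0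
count-⊥ {zero} c = refl
count-⊥ {suc n} c = count-⊥ (c ∘ suc)

count-insert : (c : Fin n → Bool) (T : Subset n) (j : Fin n) → lookup T j ≡ false →
               count c (T [ j ]≔ true) ≡ bit (c j) + count c T
count-insert c (x ∷ T) zero refl = refl
count-insert c (x ∷ T) (suc j) j∉T = trans
  (cong (bit (x ∧ c zero) +_) (count-insert (c ∘ suc) T j j∉T))
  (x+[y+z]≡y+[x+z] (bit (x ∧ c zero)) (bit (c (suc j))) (count (c ∘ suc) T))
  where
  open CommutativeSemigroupProperties ℕ.+-commutativeSemigroup renaming (x∙yz≈y∙xz to x+[y+z]≡y+[x+z])

card-insert : (T : Subset n) (j : Fin n) → lookup T j ≡ false → ∣ T [ j ]≔ true ∣ ≡ suc ∣ T ∣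
card-insert T j j∉T = begin
  ∣ T [ j ]≔ true ∣                ≡⟨ ∣S∣≡count (T [ j ]≔ true) ⟩
  count _ (T [ j ]≔ true)          ≡⟨ count-insert _ T j j∉T ⟩
  suc (count (λ _ → true) T)       ≡⟨ cong suc (∣S∣≡count T) ⟨
  suc ∣ T ∣                        ∎
  where open ≡-Reasoning

card-remove : (S : Subset n) (i : Fin n) → lookup S i ≡ true → ∣ S ∣ ≡ suc ∣ S [ i ]≔ false ∣
card-remove S i i∈S =
  trans (cong ∣_∣ (sym ([]≔-restore S i i∈S))) (card-insert (S [ i ]≔ false) i (lookup∘update i S false))

∣S∣≡0⇒S≡⊥ : (S : Subset n) → ∣ S ∣ ≡ 0 → S ≡ ⊥
∣S∣≡0⇒S≡⊥ [] _ = refl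
∣S∣≡0⇒S≡⊥ (false ∷ S) ∣S∣≡0 = cong (false ∷_) (∣S∣≡0⇒S≡⊥ S ∣S∣≡0)

∣S∣≡1⇒singleton : (S : Subset n) → ∣ S ∣ ≡ 1 → Σ (Fin n) λ i → S ≡ singleton i
∣S∣≡1⇒singleton (true ∷ S) ∣S∣≡1 = zero , cong (true ∷_) (∣S∣≡0⇒S≡⊥ S (ℕ.suc-injective ∣S∣≡1))
∣S∣≡1⇒singleton (false ∷ S) ∣S∣≡1 with ∣S∣≡1⇒singleton S ∣S∣≡1
... | i , refl = suc i , refl

lookup-act : (g : Permutation′ n) (S : Subset n) (j : Fin n) → lookup (act g S) (g ⟨$⟩ʳ j) ≡ lookup S j
lookup-act g S j = trans (lookup∘tabulate _ (g ⟨$⟩ʳ j)) (cong (lookup S) (inverseˡ g))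

act-update : (g : Permutation′ n) (S : Subset n) (j : Fin n) (b : Bool) →
             act g (S [ j ]≔ b) ≡ act g S [ g ⟨$⟩ʳ j ]≔ b
act-update g S j b = lookup-ext λ k → pointwise k (k ≟ᶠ g ⟨$⟩ʳ j)
  where
  pointwise : ∀ k → Dec (k ≡ g ⟨$⟩ʳ j) →
              lookup (act g (S [ j ]≔ b)) k ≡ lookup (act g S [ g ⟨$⟩ʳ j ]≔ b) k
  pointwise k (yes refl) =
    trans (lookup-act g (S [ j ]≔ b) j) (trans (lookup∘update j S b) (sym (lookup∘update _ (act g S) b)))
  pointwise k (no k≢gj) = begin
    lookup (act g (S [ j ]≔ b)) k       ≡⟨ lookup∘tabulate _ k ⟩
    lookup (S [ j ]≔ b) (g ⟨$⟩ˡ k)      ≡⟨ lookup∘update′ g⁻¹k≢j S b ⟩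
    lookup S (g ⟨$⟩ˡ k)                 ≡⟨ lookup∘tabulate _ k ⟨
    lookup (act g S) k                  ≡⟨ lookup∘update′ k≢gj (act g S) b ⟨
    lookup (act g S [ g ⟨$⟩ʳ j ]≔ b) k  ∎
    where
    open ≡-Reasoning
    g⁻¹k≢j : g ⟨$⟩ˡ k ≢ j
    g⁻¹k≢j g⁻¹k≡j = k≢gj (trans (sym (inverseʳ g)) (cong (g ⟨$⟩ʳ_) g⁻¹k≡j))

act-⊥ : (g : Permutation′ n) → act g ⊥ ≡ ⊥
act-⊥ g = lookup-ext λ k →
  trans (lookup∘tabulate _ k) (trans (lookup-⊥ (g ⟨$⟩ˡ k)) (sym (lookup-⊥ k)))

count-act : (c : Fin n → Bool) (g : Permutation′ n) → (∀ k → c (g ⟨$⟩ʳ k) ≡ c k) →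
            ∀ S → count c (act g S) ≡ count c S
count-act c g c-inv S = trans (ℕ-Sum.sum-permute _ g) (ℕ-Sum.sum-cong-≗ λ k →
  cong₂ (λ a b → bit (a ∧ b)) (lookup-act g S k) (c-inv k))

card-act : (g : Permutation′ n) (S : Subset n) → ∣ act g S ∣ ≡ ∣ S ∣
card-act g S = trans (∣S∣≡count (act g S)) (trans (count-act _ g (λ _ → refl) S) (sym (∣S∣≡count S)))

Invariant : Subgroup n → (Fin n → Bool) → Set
Invariant G u = ∀ g → (G ∈G) g → ∀ j → u (g ⟨$⟩ʳ j) ≡ u j

Homogeneous : ℕ → Vect n → Set
Homogeneous k v = ∀ S → ¬ (∣ S ∣ ≡ k) → v S ≡ false

ChainInvariant : Subgroup n → Vect n → Set
ChainInvariant G v = ∀ g → (G ∈G) g → ∀ S → v (act g S) ≡ v S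

D-zero : (T : Subset n) → D (λ _ → false) T ≡ false
D-zero T = xorSum-zero λ j → if-eta (lookup T j)

D-⊥ : (w : Vect n) → D w ⊥ ≡ xorSum (w ∘ singleton)
D-⊥ w = xorSum-cong λ j → cong (λ b → if b then false else w (singleton j)) (lookup-⊥ j)

D-homogeneous : ∀ {k} {v : Vect n} → Homogeneous k v → ∀ T → ¬ (suc ∣ T ∣ ≡ k) → D v T ≡ false
D-homogeneous {v = v} v-hom T ∣T∣+1≢k = xorSum-zero λ j → term j (lookup T j) refl
  where
  term : ∀ j b → lookup T j ≡ b → (if b then false else v (T [ j ]≔ true)) ≡ false
  term j true _ = refl
  term j false j∉T = v-hom (T [ j ]≔ true) (∣T∣+1≢k ∘ trans (sym (card-insert T j j∉T)))

singleton-invariant : (G : Subgroup n) (w : Vect n) → ChainInvariant G w → Invariant G (w ∘ singleton)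
singleton-invariant G w w-inv g g∈G j = begin
  w (⊥ [ g ⟨$⟩ʳ j ]≔ true)          ≡⟨ cong (λ X → w (X [ g ⟨$⟩ʳ j ]≔ true)) (act-⊥ g) ⟨
  w (act g ⊥ [ g ⟨$⟩ʳ j ]≔ true)    ≡⟨ cong w (act-update g ⊥ j true) ⟨
  w (act g (singleton j))           ≡⟨ w-inv g g∈G (singleton j) ⟩
  w (singleton j)                   ∎
  where open ≡-Reasoning

-- u · v is the product e_u ∧ v in the exterior algebra, where e_u = Σ uᵢ eᵢ.
_·_ : (Fin n → Bool) → Vect n → Vect n
(u · v) S = xorSum (λ i → if lookup S i then u i ∧ v (S [ i ]≔ false) else false)

module _ (u : Fin n → Bool) (v : Vect n) (T : Subset n) where

  private
    insert-remove : Fin n → Fin n → Bool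
    insert-remove j i = if lookup T j then false else
      (if lookup (T [ j ]≔ true) i then u i ∧ v ((T [ j ]≔ true) [ i ]≔ false) else false)

    remove-insert : Fin n → Fin n → Bool
    remove-insert i j = if lookup T i then u i ∧
      (if lookup (T [ i ]≔ false) j then false else v ((T [ i ]≔ false) [ j ]≔ true)) else false

    diagonal : ∀ i → insert-remove i i xor remove-insert i i ≡ u i ∧ v T
    diagonal i with lookup T i in T[i]
    ... | true rewrite lookup∘update i T false | []≔-restore T i {y = false} T[i] = refl
    ... | false rewrite lookup∘update i T true | []≔-restore T i {y = true} T[i] = xor-identityʳ _

    off-diagonal : ∀ i j → j ≢ i → insert-remove j i xor remove-insert i j ≡ false
    off-diagonal i j j≢i
      rewrite lookup∘update′ (j≢i ∘ sym) T true | lookup∘update′ j≢i T false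
            | []≔-commutes {x = true} {y = false} T j i j≢i
      with lookup T i | lookup T j
    ... | true | true = cong (false xor_) (∧-zeroʳ (u i))
    ... | true | false = xor-same (u i ∧ v ((T [ i ]≔ false) [ j ]≔ true))
    ... | false | true = refl
    ... | false | false = refl

    D[u·v]-expand : D (u · v) T ≡ xorSum (λ j → xorSum (insert-remove j))
    D[u·v]-expand = xorSum-cong λ j →
      xorSum-map (λ x → if lookup T j then false else x) (if-eta (lookup T j))
      (λ i → if lookup (T [ j ]≔ true) i then u i ∧ v ((T [ j ]≔ true) [ i ]≔ false) else false)

    u·Dv-expand : (u · D v) T ≡ xorSum (λ i → xorSum (remove-insert i))
    u·Dv-expand = xorSum-cong λ i →
      xorSum-map (λ x → if lookup T i then u i ∧ x else false)
        (trans (if-cong-then (lookup T i) (∧-zeroʳ (u i))) (if-eta (lookup T i)))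
        (λ j → if lookup (T [ i ]≔ false) j then false else v ((T [ i ]≔ false) [ j ]≔ true))

  -- D is a derivation and D e_u = Σ uᵢ.
  ·-homotopy : D (u · v) T xor (u · D v) T ≡ xorSum u ∧ v T
  ·-homotopy = begin
      D (u · v) T xor (u · D v) T
    ≡⟨ cong₂ _xor_ (trans D[u·v]-expand (xorSum-comm insert-remove)) u·Dv-expand ⟩
      xorSum (λ i → xorSum (λ j → insert-remove j i)) xor xorSum (λ i → xorSum (remove-insert i))
    ≡⟨ xorSum-xor (λ i → xorSum (λ j → insert-remove j i)) (λ i → xorSum (remove-insert i)) ⟨
      xorSum (λ i → xorSum (λ j → insert-remove j i) xor xorSum (remove-insert i))
    ≡⟨ xorSum-cong (λ i → xorSum-xor (λ j → insert-remove j i) (remove-insert i)) ⟨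
      xorSum (λ i → xorSum (λ j → insert-remove j i xor remove-insert i j))
    ≡⟨ xorSum-cong (λ i → trans (xorSum-single _ i (off-diagonal i)) (diagonal i)) ⟩
      xorSum (λ i → u i ∧ v T)
    ≡⟨ xorSum-map (_∧ v T) refl u ⟨
      xorSum u ∧ v T
    ∎
    where open ≡-Reasoning

·-annihilates-zero : (u : Fin n → Bool) {w : Vect n} →
                     (∀ S → w S ≡ false) → ∀ S → (u · w) S ≡ false
·-annihilates-zero u {w} w≗0 S = xorSum-zero λ i → term i (lookup S i)
  where
  term : ∀ i b → (if b then u i ∧ w (S [ i ]≔ false) else false) ≡ false
  term i false = refl
  term i true = trans (cong (u i ∧_) (w≗0 (S [ i ]≔ false))) (∧-zeroʳ (u i))

·-homogeneous : ∀ {k} (u : Fin n → Bool) {v : Vect n} → Homogeneous k v → Homogeneous (suc k) (u · v)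
·-homogeneous {k = k} u {v} v-hom S ∣S∣≢k+1 = xorSum-zero λ i → term i (lookup S i) refl
  where
  term : ∀ i b → lookup S i ≡ b → (if b then u i ∧ v (S [ i ]≔ false) else false) ≡ false
  term i false _ = refl
  term i true i∈S =
    trans (cong (u i ∧_) (v-hom _ (∣S∣≢k+1 ∘ trans (card-remove S i i∈S) ∘ cong suc))) (∧-zeroʳ (u i))

·-invariant : (G : Subgroup n) {u : Fin n → Bool} {v : Vect n} →
              Invariant G u → ChainInvariant G v → ChainInvariant G (u · v)
·-invariant G {u} {v} u-inv v-inv g g∈G S =
  trans (xorSum-permute _ g)
        (xorSum-cong λ j → term-invariant (lookup-act g S j) (u-inv g g∈G j) (v-at-removal j))
  where
  v-at-removal : ∀ j → v (act g S [ g ⟨$⟩ʳ j ]≔ false) ≡ v (S [ j ]≔ false)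
  v-at-removal j = trans (cong v (sym (act-update g S j false))) (v-inv g g∈G (S [ j ]≔ false))
  term-invariant : ∀ {a a′ b b′ c c′} → a ≡ a′ → b ≡ b′ → c ≡ c′ →
                   (if a then b ∧ c else false) ≡ (if a′ then b′ ∧ c′ else false)
  term-invariant refl refl refl = refl

acyclic-of-odd-invariant-weight : (G : Subgroup n) (u : Fin n → Bool) →
                                  Invariant G u → xorSum u ≡ true → Acyclic G
acyclic-of-odd-invariant-weight G u u-inv Σu≡1 k v ((v-hom , v-inv) , v-cycle) =
  u · v , (·-homogeneous u v-hom , ·-invariant G u-inv v-inv) , D[u·v]≡v
  where
  D[u·v]≡v : ∀ T → D (u · v) T ≡ v T
  D[u·v]≡v T = begin
    D (u · v) T                    ≡⟨ xor-identityʳ _ ⟨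
    D (u · v) T xor false          ≡⟨ cong (D (u · v) T xor_) (·-annihilates-zero u v-cycle T) ⟨
    D (u · v) T xor (u · D v) T    ≡⟨ ·-homotopy u v T ⟩
    xorSum u ∧ v T                 ≡⟨ cong (_∧ v T) Σu≡1 ⟩
    v T                            ∎
    where open ≡-Reasoning

acyclic-of-odd-invariant-subset : (G : Subgroup n) (U : Subset n) →
                                  Invariant G (lookup U) → ∣ U ∣ % 2 ≡ 1 → Acyclic G
acyclic-of-odd-invariant-subset G U U-inv odd =
  acyclic-of-odd-invariant-weight G (lookup U) U-inv (trans (xorSum-lookup U) (parity-odd ∣ U ∣ odd))

orbit-closed : (G : Subgroup n) {O : Subset n} → IsOrbit G O →
               ∀ {g j} → (G ∈G) g → j ∈ O → g ⟨$⟩ʳ j ∈ O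
orbit-closed G (i , orbit) {g} g∈G j∈O with Equivalence.to (orbit _) j∈O
... | h , h∈G , refl = Equivalence.from (orbit _) (h ∘ₚ g , ∘∈G G h∈G g∈G , refl)

closed⇒invariant : (G : Subgroup n) {O : Subset n} →
                   (∀ {g j} → (G ∈G) g → j ∈ O → g ⟨$⟩ʳ j ∈ O) → Invariant G (lookup O)
closed⇒invariant G {O} closed g g∈G j with lookup O j in O[j] | lookup O (g ⟨$⟩ʳ j) in O[gj]
... | true | true = refl
... | false | false = refl
... | true | false = contradiction (trans (sym ([]=⇒lookup (closed g∈G (lookup⇒[]= j O O[j])))) O[gj]) λ ()
... | false | true =
  contradiction (trans (sym ([]=⇒lookup g⁻¹gj∈O)) (trans (cong (lookup O) (inverseˡ g)) O[j])) λ ()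
  where
  g⁻¹gj∈O : flip g ⟨$⟩ʳ (g ⟨$⟩ʳ j) ∈ O
  g⁻¹gj∈O = closed (inv∈G G g∈G) (lookup⇒[]= _ O O[gj])

acyclic-of-odd-degree : (G : Subgroup n) → n % 2 ≡ 1 → Acyclic G
acyclic-of-odd-degree {n} G odd =
  acyclic-of-odd-invariant-subset G ⊤
    (λ g _ j → trans (lookup-replicate (g ⟨$⟩ʳ j) true) (sym (lookup-replicate j true)))
    (trans (cong (_% 2) (∣⊤∣≡n n)) odd)

acyclic-of-odd-orbit : (G : Subgroup n) → HasOddOrbit G → Acyclic G
acyclic-of-odd-orbit G (O , O-orbit , odd) =
  acyclic-of-odd-invariant-subset G O (closed⇒invariant G (orbit-closed G O-orbit)) odd

H₀≅𝔽₂ : (G : Subgroup n) → ¬ Acyclic G → HomologyIsF2 G 0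
H₀≅𝔽₂ {n} G ¬acyclic = (λ v → v ⊥) , (λ _ _ _ _ → refl) , kernel⇔boundary , δ , δ-cycle , δ-⊥
  where
  δ : Vect n
  δ S = does (∣ S ∣ ≟ 0)

  δ-hom : Homogeneous 0 δ
  δ-hom S = dec-false (∣ S ∣ ≟ 0)

  δ-cycle : Cycle G 0 δ
  δ-cycle = (δ-hom , λ g _ S → cong (does ∘ (_≟ 0)) (card-act g S)) , λ T → D-homogeneous δ-hom T λ ()

  δ-⊥ : δ ⊥ ≡ true
  δ-⊥ rewrite ∣⊥∣≡0 n = refl

  kernel⇔boundary : ∀ v → Cycle G 0 v → (v ⊥ ≡ false) ⇔ Boundary G 0 v
  kernel⇔boundary v ((v-hom , _) , _) = mk⇔ zero-bounds boundary-vanishes-at-⊥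
    where
    zero-bounds : v ⊥ ≡ false → Boundary G 0 v
    zero-bounds v⊥≡0 =
      (λ _ → false) , ((λ _ _ → refl) , (λ _ _ _ → refl)) , λ T → trans (D-zero T) (sym (v≗0 T))
      where
      v≗0 : ∀ T → v T ≡ false
      v≗0 T with ∣ T ∣ ≟ 0
      ... | yes ∣T∣≡0 = trans (cong v (∣S∣≡0⇒S≡⊥ T ∣T∣≡0)) v⊥≡0
      ... | no ∣T∣≢0 = v-hom T ∣T∣≢0

    -- Otherwise w on singletons is an invariant weight of odd total, and the complex is acyclic.
    boundary-vanishes-at-⊥ : Boundary G 0 v → v ⊥ ≡ false
    boundary-vanishes-at-⊥ (w , (_ , w-inv) , Dw≡v) with xorSum (w ∘ singleton) in Σw
    ... | false = trans (sym (Dw≡v ⊥)) (trans (D-⊥ w) Σw)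
    ... | true = ⊥-elim (¬acyclic (acyclic-of-odd-invariant-weight G _ (singleton-invariant G w w-inv) Σw))

H₁-vanishes : (G : Subgroup n) → HomologyVanishes G 1
H₁-vanishes {n} G v ((v-hom , v-inv) , v-cycle) = w , (w-hom , w-inv) , Dw≡v
  where
  c : Fin n → Bool
  c = v ∘ singleton

  Σc≡0 : xorSum c ≡ false
  Σc≡0 = trans (sym (D-⊥ v)) (v-cycle ⊥)

  -- The sum of e_S over the pairs S ⊆ {i | c i}: its boundary at {i} is c i ∧ Σ_{j ≠ i} c j,
  -- which is c i because Σ c = (D v)(∅) = 0.
  w : Vect n
  w S = does (∣ S ∣ ≟ 2) ∧ does (count c S ≟ 2)

  w-hom : Homogeneous 2 w
  w-hom S ∣S∣≢2 rewrite dec-false (∣ S ∣ ≟ 2) ∣S∣≢2 = refl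

  w-inv : ChainInvariant G w
  w-inv g g∈G S = cong₂ (λ a b → does (a ≟ 2) ∧ does (b ≟ 2))
    (card-act g S) (count-act c g (singleton-invariant G v v-inv g g∈G) S)

  w-pair : ∀ i j → j ≢ i → w (singleton i [ j ]≔ true) ≡ c i ∧ c j
  w-pair i j j≢i =
    trans (cong₂ (λ a b → does (a ≟ 2) ∧ does (b ≟ 2)) card≡2 count≡) (pair-count (c i) (c j))
    where
    j∉⁅i⁆ : lookup (singleton i) j ≡ false
    j∉⁅i⁆ = trans (lookup∘update′ j≢i ⊥ true) (lookup-⊥ j)
    card≡2 : ∣ singleton i [ j ]≔ true ∣ ≡ 2
    card≡2 = trans (card-insert (singleton i) j j∉⁅i⁆)
                   (cong suc (trans (card-insert ⊥ i (lookup-⊥ i)) (cong suc (∣⊥∣≡0 n))))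
    count≡ : count c (singleton i [ j ]≔ true) ≡ bit (c j) + (bit (c i) + 0)
    count≡ = trans (count-insert c (singleton i) j j∉⁅i⁆)
                   (cong (bit (c j) +_) (trans (count-insert c ⊥ i (lookup-⊥ i))
                                               (cong (bit (c i) +_) (count-⊥ c))))
    pair-count : ∀ a b → does (bit b + (bit a + 0) ≟ 2) ≡ a ∧ b
    pair-count true true = refl
    pair-count true false = refl
    pair-count false true = refl
    pair-count false false = refl

  Dw-at-singleton : ∀ i → D w (singleton i) ≡ c i
  Dw-at-singleton i = begin
    D w (singleton i)                                  ≡⟨ xor-identityʳ _ ⟨
    D w (singleton i) xor false                        ≡⟨ cong (D w (singleton i) xor_) Σc·c≡0 ⟨
    D w (singleton i) xor xorSum (λ j → c i ∧ c j)     ≡⟨ xorSum-xor term (λ j → c i ∧ c j) ⟨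
    xorSum (λ j → term j xor (c i ∧ c j))              ≡⟨ xorSum-single _ i off-diagonal ⟩
    term i xor (c i ∧ c i)                             ≡⟨ cong (_xor (c i ∧ c i)) term-diagonal ⟩
    c i ∧ c i                                          ≡⟨ ∧-idem (c i) ⟩
    c i                                                ∎
    where
    open ≡-Reasoning
    term : Fin n → Bool
    term j = if lookup (singleton i) j then false else w (singleton i [ j ]≔ true)
    term-diagonal : term i ≡ false
    term-diagonal = if-cong (lookup∘update i ⊥ true)
    Σc·c≡0 : xorSum (λ j → c i ∧ c j) ≡ false
    Σc·c≡0 = trans (sym (∧-distribˡ-xorSum (c i) c)) (trans (cong (c i ∧_) Σc≡0) (∧-zeroʳ (c i)))
    off-diagonal : ∀ j → j ≢ i → term j xor (c i ∧ c j) ≡ false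
    off-diagonal j j≢i rewrite lookup∘update′ j≢i ⊥ true | lookup-⊥ j | w-pair i j j≢i =
      xor-same (c i ∧ c j)

  Dw≡v : ∀ T → D w T ≡ v T
  Dw≡v T with ∣ T ∣ ≟ 1
  ... | no ∣T∣≢1 = trans (D-homogeneous w-hom T (∣T∣≢1 ∘ ℕ.suc-injective)) (sym (v-hom T ∣T∣≢1))
  ... | yes ∣T∣≡1 with ∣S∣≡1⇒singleton T ∣T∣≡1
  ...   | i , refl = Dw-at-singleton i

theorem2p5 : (n : ℕ) (G : Subgroup n) →
    (n % 2 ≡ 1 → Acyclic G) ×
    (HasOddOrbit G → Acyclic G) ×
    (¬ Acyclic G → HomologyIsF2 G 0 × HomologyVanishes G 1)
theorem2p5 n G =
  acyclic-of-odd-degree G ,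
  acyclic-of-odd-orbit G ,
  λ ¬acyclic → H₀≅𝔽₂ G ¬acyclic , H₁-vanishes G
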